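{- Let $l,m,n$ be nonnegative integers. Then $$\sum_{k=0}^l(-1)^{m-k}\binom{l}{k}\binom{m-k}{n}\binom{2k}{k-2l+m} =\sum_{k=0}^l\binom lk\binom{2k}n\binom{n-l}{m+n-3k-l}.$$
   Context: For any (real or complex) number $x$ and integer $k$, the binomial coefficient is defined by $\binom xk=\frac1{k!}\prod_{j=0}^{k-1}(x-j)$ if $k>0$, $\binom x0=1$, and $\binom xk=0$ if $k<0$. In particular the upper argument may be negative (e.g. $n-l<0$). -}

module Defs where

open import Data.Nat as ℕ using (ℕ; zero; suc; _!; _%_)
open import Data.Nat.Properties using (_!≢0)
open import Data.Integer as ℤ using (ℤ; +_; _+_; _-_; _*_; -_; _/ℕ_; ∣_∣)

falling : ℤ → ℕ → ℤ
falling x zero    = + 1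
falling x (suc k) = falling x k * (x - + k)

-- binom x k = (1/k!) ∏_{j=0}^{k-1} (x-j) for k > 0, 1 for k = 0, 0 for k < 0.
-- The product is always divisible by k!, so integer division is exact.
binom : ℤ → ℤ → ℤ
binom x (+ k)      = _/ℕ_ (falling x k) (k !) {{k !≢0}}
binom x ℤ.-[1+ _ ] = + 0

sgnPow : ℤ → ℤ
sgnPow z with ∣ z ∣ % 2
... | zero = + 1
... | suc _ = - (+ 1)

sumTo : ℕ → (ℕ → ℤ) → ℤ
sumTo zero    f = f 0
sumTo (suc l) f = sumTo l f + f (suc l)

-- Generalise m and n to integers M and N and write lhs l M N, rhs l M N for the two sides.
-- Both satisfy the recurrence F (l + 1) = step (F l), a fixed linear combination of shifts of F l
-- in M and N, and at l = 0 both equal [M = 0][N = 0].  For the left side the recurrence comes from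
-- Pascal's rule applied to C(l+1, k), twice to C(2k+2, ·), and to C(M−k, N) together with the sign.
-- For the right side Pascal's rule yields it only after multiplying by 1 + x, x marking M:
-- rhs (l+1) M N + rhs (l+1) (M−1) N equals the same combination of step (rhs l).  Since both
-- rhs (l+1) and step (rhs l) vanish at M = −1, the factor 1 + x cancels.  Pascal's rule for binom
-- with an arbitrary integer upper argument is inherited from the falling factorial once k! is
-- known to divide it.
module Submission where

open import Defs
open import Data.Nat using (ℕ)
open import Data.Integer using (ℤ; +_; _+_; _-_; _*_)
open import Relation.Binary.PropositionalEquality using (_≡_)
open import Data.Nat as ℕ using (zero; suc; _!; z≤n; s≤s)
open import Data.Nat.Properties as ℕP using (_!≢0)
open import Data.Nat.DivMod using (m*n/n≡m; m*n%n≡0; 0/n≡0)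
open import Data.Integer using (-[1+_]; -_; _/ℕ_; _≤_; _<_; -1ℤ; +≤+; +<+; -<+)
open import Data.Integer.Properties
open import Data.Integer.Divisibility.Signed
  using (_∣_; divides; ∣-refl; ∣m∣n⇒∣m+n; ∣m+n∣n⇒∣m; *-monoʳ-∣)
open import Data.Integer.Tactic.RingSolver using (solve-∀)
open import Data.Sum using (inj₁; inj₂)
open import Relation.Nullary using (yes; no)
open import Relation.Binary.PropositionalEquality using (refl; sym; trans; cong; cong₂; subst; module ≡-Reasoning)
open import Algebra.Properties.AbelianGroup +-0-abelianGroup using (∙-cancelˡ; ∙-cancelʳ)
open import Algebra.Properties.CommutativeSemigroup +-commutativeSemigroup
  using () renaming (interchange to +-interchange)
open import Algebra.Properties.CommutativeSemigroup *-commutativeSemigroup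
  using () renaming (x∙yz≈y∙xz to *-x∙yz≈y∙xz)

falling-1+ : ∀ x k → falling (+ 1 + x) (suc k) ≡ (+ 1 + x) * falling x k
falling-1+ x zero    = unit x
  where
  unit : ∀ x → + 1 * (+ 1 + x - + 0) ≡ (+ 1 + x) * + 1
  unit = solve-∀
falling-1+ x (suc k) = begin
  falling (+ 1 + x) (suc k) * (+ 1 + x - + suc k) ≡⟨ cong (_* (+ 1 + x - + suc k)) (falling-1+ x k) ⟩
  (+ 1 + x) * falling x k * (+ 1 + x - (+ 1 + + k)) ≡⟨ regroup x (falling x k) (+ k) ⟩
  (+ 1 + x) * (falling x k * (x - + k)) ∎
  where
  open ≡-Reasoning
  regroup : ∀ x f k → (+ 1 + x) * f * (+ 1 + x - (+ 1 + k)) ≡ (+ 1 + x) * (f * (x - k))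
  regroup = solve-∀

falling-pascal : ∀ x k → falling (+ 1 + x) (suc k) ≡ falling x (suc k) + + suc k * falling x k
falling-pascal x k = trans (falling-1+ x k) (split x (falling x k) (+ k))
  where
  split : ∀ x f k → (+ 1 + x) * f ≡ f * (x - k) + (+ 1 + k) * f
  split = solve-∀

n<k⇒falling≡0 : ∀ {n k} → n ℕ.< k → falling (+ n) k ≡ + 0
n<k⇒falling≡0 {n} {suc k} (s≤s n≤k) with ℕP.m≤n⇒m<n∨m≡n n≤k
... | inj₁ n<k  = trans (cong (_* (+ n - + k)) (n<k⇒falling≡0 n<k)) (*-zeroˡ (+ n - + k))
... | inj₂ refl = trans (cong (falling (+ n) n *_) (+-inverseʳ (+ n))) (*-zeroʳ (falling (+ n) n))

k!∣falling : ∀ k x → + (k !) ∣ falling x k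
k!∣falling zero    x = ∣-refl
-- Pascal's rule for falling carries divisibility from x to 1 + x and back, starting from x = 0.
k!∣falling (suc k) = from-ℤ
  where
  d = + (suc k !)
  tail : ∀ x → d ∣ + suc k * falling x k
  tail x = subst (_∣ + suc k * falling x k) (sym (pos-* (suc k) (k !))) (*-monoʳ-∣ (+ suc k) (k!∣falling k x))
  up : ∀ x → d ∣ falling x (suc k) → d ∣ falling (+ 1 + x) (suc k)
  up x d∣ = subst (d ∣_) (sym (falling-pascal x k)) (∣m∣n⇒∣m+n d∣ (tail x))
  down : ∀ x → d ∣ falling (+ 1 + x) (suc k) → d ∣ falling x (suc k)
  down x d∣ = ∣m+n∣n⇒∣m (subst (d ∣_) (falling-pascal x k) d∣) (tail x)
  from-ℕ : ∀ n → d ∣ falling (+ n) (suc k)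
  from-ℕ zero    = divides (+ 0) (n<k⇒falling≡0 {0} {suc k} (s≤s z≤n))
  from-ℕ (suc n) = up (+ n) (from-ℕ n)
  from-neg : ∀ n → d ∣ falling -[1+ n ] (suc k)
  from-neg zero    = down -[1+ 0 ] (from-ℕ 0)
  from-neg (suc n) = down -[1+ suc n ] (from-neg n)
  from-ℤ : ∀ x → d ∣ falling x (suc k)
  from-ℤ (+ n)    = from-ℕ n
  from-ℤ -[1+ n ] = from-neg n

[i*n]/ℕn≡i : ∀ i n .{{_ : ℕ.NonZero n}} → (i * + n) /ℕ n ≡ i
[i*n]/ℕn≡i (+ m)    n       = trans (cong (_/ℕ n) (sym (pos-* m n))) (cong +_ (m*n/n≡m m n))
[i*n]/ℕn≡i -[1+ m ] (suc n) rewrite m*n%n≡0 (suc m) (suc n) {{_}} =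
  cong (λ q → - (+ q)) (m*n/n≡m (suc m) (suc n))

binom*k!≡falling : ∀ x k → binom x (+ k) * + (k !) ≡ falling x k
binom*k!≡falling x k with k!∣falling k x
... | divides q eq = begin
  (falling x k /ℕ k !) * + (k !)   ≡⟨ cong (λ y → (y /ℕ k !) * + (k !)) eq ⟩
  ((q * + (k !)) /ℕ k !) * + (k !) ≡⟨ cong (_* + (k !)) ([i*n]/ℕn≡i q (k !)) ⟩
  q * + (k !)                      ≡⟨ eq ⟨
  falling x k                      ∎
  where
  open ≡-Reasoning
  instance _ = k !≢0

binom-pascal : ∀ x K → binom (+ 1 + x) K ≡ binom x K + binom x (K - + 1)
binom-pascal x -[1+ _ ] = refl
binom-pascal x (+ zero)  = refl
binom-pascal x (+ suc k) = *-cancelʳ-≡ _ _ (+ (suc k !)) (begin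
  binom (+ 1 + x) (+ suc k) * + (suc k !)
    ≡⟨ binom*k!≡falling (+ 1 + x) (suc k) ⟩
  falling (+ 1 + x) (suc k)
    ≡⟨ falling-pascal x k ⟩
  falling x (suc k) + + suc k * falling x k
    ≡⟨ cong₂ (λ a b → a + + suc k * b) (binom*k!≡falling x (suc k)) (binom*k!≡falling x k) ⟨
  binom x (+ suc k) * + (suc k !) + + suc k * (binom x (+ k) * + (k !))
    ≡⟨ cong (λ f → binom x (+ suc k) * f + + suc k * (binom x (+ k) * + (k !))) (pos-* (suc k) (k !)) ⟩
  binom x (+ suc k) * (+ suc k * + (k !)) + + suc k * (binom x (+ k) * + (k !))
    ≡⟨ factor (binom x (+ suc k)) (binom x (+ k)) (+ suc k) (+ (k !)) ⟩
  (binom x (+ suc k) + binom x (+ k)) * (+ suc k * + (k !))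
    ≡⟨ cong ((binom x (+ suc k) + binom x (+ k)) *_) (pos-* (suc k) (k !)) ⟨
  (binom x (+ suc k) + binom x (+ k)) * + (suc k !) ∎)
  where
  open ≡-Reasoning
  instance _ = suc k !≢0
  factor : ∀ a b s f → a * (s * f) + s * (b * f) ≡ (a + b) * (s * f)
  factor = solve-∀

binom-pascal₂ : ∀ x K → binom (+ 2 + x) K ≡ binom x K + + 2 * binom x (K - + 1) + binom x (K - + 2)
binom-pascal₂ x K = begin
  binom (+ 2 + x) K
    ≡⟨ cong (λ y → binom y K) (+-assoc (+ 1) (+ 1) x) ⟩
  binom (+ 1 + (+ 1 + x)) K
    ≡⟨ binom-pascal (+ 1 + x) K ⟩
  binom (+ 1 + x) K + binom (+ 1 + x) (K - + 1)
    ≡⟨ cong₂ _+_ (binom-pascal x K) (binom-pascal x (K - + 1)) ⟩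
  (binom x K + binom x (K - + 1)) + (binom x (K - + 1) + binom x (K - + 1 - + 1))
    ≡⟨ cong (λ L → (binom x K + binom x (K - + 1)) + (binom x (K - + 1) + binom x L)) (+-assoc K (- + 1) (- + 1)) ⟩
  (binom x K + binom x (K - + 1)) + (binom x (K - + 1) + binom x (K - + 2))
    ≡⟨ collect (binom x K) (binom x (K - + 1)) (binom x (K - + 2)) ⟩
  binom x K + + 2 * binom x (K - + 1) + binom x (K - + 2) ∎
  where
  open ≡-Reasoning
  collect : ∀ a b c → (a + b) + (b + c) ≡ a + + 2 * b + c
  collect = solve-∀

n<K⇒binom≡0 : ∀ {n} K → + n < K → binom (+ n) K ≡ + 0
n<K⇒binom≡0 (+ k) (+<+ n<k) = trans (cong (_/ℕ k !) (n<k⇒falling≡0 n<k)) (cong +_ (0/n≡0 (k !)))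
  where instance _ = k !≢0

K<0⇒binom≡0 : ∀ x {K} → K < + 0 → binom x K ≡ + 0
K<0⇒binom≡0 x { -[1+ _ ]} _         = refl
K<0⇒binom≡0 x {+ _}      (+<+ ())

sgnPow-suc : ∀ n → sgnPow (+ suc n) ≡ - sgnPow (+ n)
sgnPow-suc zero    = refl
sgnPow-suc (suc n) = trans (sym (neg-involutive (sgnPow (+ n)))) (cong -_ (sym (sgnPow-suc n)))

sgnPow-1+ : ∀ z → sgnPow (+ 1 + z) ≡ - sgnPow z
sgnPow-1+ (+ n)          = sgnPow-suc n
sgnPow-1+ -[1+ zero ]    = refl
-- sgnPow only inspects ∣ z ∣, so sgnPow -[1+ n ] is definitionally sgnPow (+ suc n).
sgnPow-1+ -[1+ suc n ]   = trans (sym (neg-involutive (sgnPow -[1+ n ]))) (cong -_ (sym (sgnPow-suc (suc n))))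

sgnPow-2+ : ∀ z → sgnPow (+ 2 + z) ≡ sgnPow z
sgnPow-2+ z = begin
  sgnPow (+ 2 + z)         ≡⟨ cong sgnPow (+-assoc (+ 1) (+ 1) z) ⟩
  sgnPow (+ 1 + (+ 1 + z)) ≡⟨ sgnPow-1+ (+ 1 + z) ⟩
  - sgnPow (+ 1 + z)       ≡⟨ cong -_ (sgnPow-1+ z) ⟩
  - - sgnPow z             ≡⟨ neg-involutive (sgnPow z) ⟩
  sgnPow z                 ∎
  where open ≡-Reasoning

sumTo-cong : ∀ l {f g : ℕ → ℤ} → (∀ k → f k ≡ g k) → sumTo l f ≡ sumTo l g
sumTo-cong zero    f≡g = f≡g 0
sumTo-cong (suc l) f≡g = cong₂ _+_ (sumTo-cong l f≡g) (f≡g (suc l))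

sumTo-zero : ∀ l {f : ℕ → ℤ} → (∀ k → f k ≡ + 0) → sumTo l f ≡ + 0
sumTo-zero zero    f≡0 = f≡0 0
sumTo-zero (suc l) f≡0 = cong₂ _+_ (sumTo-zero l f≡0) (f≡0 (suc l))

sumTo-+ : ∀ l (f g : ℕ → ℤ) → sumTo l (λ k → f k + g k) ≡ sumTo l f + sumTo l g
sumTo-+ zero    f g = refl
sumTo-+ (suc l) f g = trans (cong (_+ (f (suc l) + g (suc l))) (sumTo-+ l f g))
                            (+-interchange (sumTo l f) (sumTo l g) (f (suc l)) (g (suc l)))

sumTo-* : ∀ l c (f : ℕ → ℤ) → sumTo l (λ k → c * f k) ≡ c * sumTo l f
sumTo-* zero    c f = refl
sumTo-* (suc l) c f = trans (cong (_+ c * f (suc l)) (sumTo-* l c f)) (sym (*-distribˡ-+ c (sumTo l f) (f (suc l))))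

sumTo-suc : ∀ l (f : ℕ → ℤ) → sumTo (suc l) f ≡ f 0 + sumTo l (λ k → f (suc k))
sumTo-suc zero    f = refl
sumTo-suc (suc l) f = trans (cong (_+ f (suc (suc l))) (sumTo-suc l f)) (+-assoc (f 0) _ _)

≡-from-consecutive-sums : ∀ {F G : ℤ → ℤ} → F -1ℤ ≡ G -1ℤ →
  (∀ M → F M + F (M - + 1) ≡ G M + G (M - + 1)) → ∀ M → F M ≡ G M
≡-from-consecutive-sums {F} {G} F-1≡G-1 sums = from-ℤ
  where
  from-ℕ : ∀ n → F (+ n) ≡ G (+ n)
  from-ℕ zero    = ∙-cancelʳ (F -1ℤ) (F (+ 0)) (G (+ 0))
                     (trans (sums (+ 0)) (cong (_+_ (G (+ 0))) (sym F-1≡G-1)))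
  from-ℕ (suc n) = ∙-cancelʳ (F (+ n)) (F (+ suc n)) (G (+ suc n))
                     (trans (sums (+ suc n)) (cong (_+_ (G (+ suc n))) (sym (from-ℕ n))))
  from-neg : ∀ n → F -[1+ n ] ≡ G -[1+ n ]
  from-neg zero    = F-1≡G-1
  from-neg (suc n) = ∙-cancelˡ (F -[1+ n ]) (F -[1+ suc n ]) (G -[1+ suc n ])
    (subst (λ j → F -[1+ n ] + F -[1+ suc j ] ≡ F -[1+ n ] + G -[1+ suc j ]) (ℕP.+-identityʳ n)
           (trans (sums -[1+ n ]) (cong (_+ G (-[1+ n ] - + 1)) (sym (from-neg n)))))
  from-ℤ : ∀ M → F M ≡ G M
  from-ℤ (+ n)    = from-ℕ n
  from-ℤ -[1+ n ] = from-neg n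

binomialSum : ℕ → (ℕ → ℤ) → ℤ
binomialSum l g = sumTo l (λ k → binom (+ l) (+ k) * g k)

binomialSum-cong : ∀ l {g h : ℕ → ℤ} → (∀ k → g k ≡ h k) → binomialSum l g ≡ binomialSum l h
binomialSum-cong l g≡h = sumTo-cong l (λ k → cong (binom (+ l) (+ k) *_) (g≡h k))

binomialSum-+ : ∀ l (g h : ℕ → ℤ) → binomialSum l (λ k → g k + h k) ≡ binomialSum l g + binomialSum l h
binomialSum-+ l g h = trans (sumTo-cong l (λ k → *-distribˡ-+ (binom (+ l) (+ k)) (g k) (h k))) (sumTo-+ l _ _)

binomialSum-* : ∀ l c (g : ℕ → ℤ) → binomialSum l (λ k → c * g k) ≡ c * binomialSum l g
binomialSum-* l c g = trans (sumTo-cong l (λ k → *-x∙yz≈y∙xz (binom (+ l) (+ k)) c (g k))) (sumTo-* l c _)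

binomialSum-neg : ∀ l (g : ℕ → ℤ) → binomialSum l (λ k → - g k) ≡ - binomialSum l g
binomialSum-neg l g = begin
  binomialSum l (λ k → - g k)      ≡⟨ binomialSum-cong l (λ k → -1*i≡-i (g k)) ⟨
  binomialSum l (λ k → - + 1 * g k) ≡⟨ binomialSum-* l (- + 1) g ⟩
  - + 1 * binomialSum l g           ≡⟨ -1*i≡-i (binomialSum l g) ⟩
  - binomialSum l g                 ∎
  where open ≡-Reasoning

binomialSum-1-2-1 : ∀ l {g h₀ h₁ h₂ : ℕ → ℤ} → (∀ k → g k ≡ h₀ k + + 2 * h₁ k + h₂ k) →
                    binomialSum l g ≡ binomialSum l h₀ + + 2 * binomialSum l h₁ + binomialSum l h₂
binomialSum-1-2-1 l {g} {h₀} {h₁} {h₂} g≡ = begin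
  binomialSum l g
    ≡⟨ binomialSum-cong l g≡ ⟩
  binomialSum l (λ k → h₀ k + + 2 * h₁ k + h₂ k)
    ≡⟨ binomialSum-+ l _ h₂ ⟩
  binomialSum l (λ k → h₀ k + + 2 * h₁ k) + binomialSum l h₂
    ≡⟨ cong (_+ binomialSum l h₂) (binomialSum-+ l h₀ _) ⟩
  binomialSum l h₀ + binomialSum l (λ k → + 2 * h₁ k) + binomialSum l h₂
    ≡⟨ cong (λ s → binomialSum l h₀ + s + binomialSum l h₂) (binomialSum-* l (+ 2) h₁) ⟩
  binomialSum l h₀ + + 2 * binomialSum l h₁ + binomialSum l h₂ ∎
  where open ≡-Reasoning

binomialSum-suc : ∀ l (g : ℕ → ℤ) → binomialSum (suc l) g ≡ binomialSum l g + binomialSum l (λ k → g (suc k))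
binomialSum-suc l g = begin
  binomialSum (suc l) g
    ≡⟨ sumTo-cong (suc l) (λ k → trans (cong (_* g k) (binom-pascal (+ l) (+ k)))
                                        (*-distribʳ-+ (g k) (binom (+ l) (+ k)) (binom (+ l) (+ k - + 1)))) ⟩
  sumTo (suc l) (λ k → binom (+ l) (+ k) * g k + binom (+ l) (+ k - + 1) * g k)
    ≡⟨ sumTo-+ (suc l) _ _ ⟩
  (binomialSum l g + binom (+ l) (+ suc l) * g (suc l)) + sumTo (suc l) (λ k → binom (+ l) (+ k - + 1) * g k)
    ≡⟨ cong₂ _+_ (cong (λ t → binomialSum l g + t) top-vanishes) (sumTo-suc l _) ⟩
  (binomialSum l g + + 0) + (+ 0 + binomialSum l (λ k → g (suc k)))
    ≡⟨ cong₂ _+_ (+-identityʳ (binomialSum l g)) (+-identityˡ _) ⟩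
  binomialSum l g + binomialSum l (λ k → g (suc k)) ∎
  where
  open ≡-Reasoning
  top-vanishes : binom (+ l) (+ suc l) * g (suc l) ≡ + 0
  top-vanishes = trans (cong (_* g (suc l)) (n<K⇒binom≡0 (+ suc l) (+<+ ℕP.≤-refl))) (*-zeroˡ (g (suc l)))

pos-*-suc : ∀ c k → + (c ℕ.* suc k) ≡ + c + + (c ℕ.* k)
pos-*-suc c k = trans (cong +_ (ℕP.*-suc c k)) (pos-+ c (c ℕ.* k))

lhsKernel : ℤ → ℤ → ℤ → ℕ → ℤ
lhsKernel a b n k = sgnPow (a - + k) * binom (a - + k) n * binom (+ (2 ℕ.* k)) (+ k + b)

lhsSum : ℕ → ℤ → ℤ → ℤ → ℤ
lhsSum l a b n = binomialSum l (lhsKernel a b n)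

lhsKernel-1+ : ∀ a b n k → lhsKernel (+ 1 + a) b n k ≡ - (lhsKernel a b n k + lhsKernel a b (n - + 1) k)
lhsKernel-1+ a b n k = begin
  sgnPow (+ 1 + a - + k) * binom (+ 1 + a - + k) n * d
    ≡⟨ cong (λ z → sgnPow z * binom z n * d) (+-assoc (+ 1) a (- + k)) ⟩
  sgnPow (+ 1 + (a - + k)) * binom (+ 1 + (a - + k)) n * d
    ≡⟨ cong₂ (λ s c → s * c * d) (sgnPow-1+ (a - + k)) (binom-pascal (a - + k) n) ⟩
  - sgnPow (a - + k) * (binom (a - + k) n + binom (a - + k) (n - + 1)) * d
    ≡⟨ distrib (sgnPow (a - + k)) (binom (a - + k) n) (binom (a - + k) (n - + 1)) d ⟩
  - (lhsKernel a b n k + lhsKernel a b (n - + 1) k) ∎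
  where
  open ≡-Reasoning
  d = binom (+ (2 ℕ.* k)) (+ k + b)
  distrib : ∀ s x y d → - s * (x + y) * d ≡ - (s * x * d + s * y * d)
  distrib = solve-∀

lhsKernel-2+ : ∀ a b n k →
  lhsKernel (+ 2 + a) b n k ≡ lhsKernel a b n k + + 2 * lhsKernel a b (n - + 1) k + lhsKernel a b (n - + 2) k
lhsKernel-2+ a b n k = begin
  sgnPow (+ 2 + a - + k) * binom (+ 2 + a - + k) n * d
    ≡⟨ cong (λ z → sgnPow z * binom z n * d) (+-assoc (+ 2) a (- + k)) ⟩
  sgnPow (+ 2 + (a - + k)) * binom (+ 2 + (a - + k)) n * d
    ≡⟨ cong₂ (λ s c → s * c * d) (sgnPow-2+ (a - + k)) (binom-pascal₂ (a - + k) n) ⟩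
  sgnPow (a - + k) * (binom (a - + k) n + + 2 * binom (a - + k) (n - + 1) + binom (a - + k) (n - + 2)) * d
    ≡⟨ distrib (sgnPow (a - + k)) (binom (a - + k) n) (binom (a - + k) (n - + 1)) (binom (a - + k) (n - + 2)) d ⟩
  lhsKernel a b n k + + 2 * lhsKernel a b (n - + 1) k + lhsKernel a b (n - + 2) k ∎
  where
  open ≡-Reasoning
  d = binom (+ (2 ℕ.* k)) (+ k + b)
  distrib : ∀ s x y z d → s * (x + + 2 * y + z) * d ≡ s * x * d + + 2 * (s * y * d) + s * z * d
  distrib = solve-∀

lhsKernel-suc : ∀ a b n k → lhsKernel a b n (suc k) ≡
  lhsKernel (a - + 1) (b + + 1) n k + + 2 * lhsKernel (a - + 1) b n k + lhsKernel (a - + 1) (b - + 1) n k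
lhsKernel-suc a b n k = begin
  sgnPow (a - + suc k) * binom (a - + suc k) n * binom (+ (2 ℕ.* suc k)) (+ suc k + b)
    ≡⟨ cong (λ z → sgnPow z * binom z n * binom (+ (2 ℕ.* suc k)) (+ suc k + b)) (a-[1+k]≡a-1-k a (+ k)) ⟩
  s * c * binom (+ (2 ℕ.* suc k)) (+ suc k + b)
    ≡⟨ cong₂ (λ y K → s * c * binom y K) (pos-*-suc 2 k) ([1+k]+b≡k+[b+1] (+ k) b) ⟩
  s * c * binom (+ 2 + + (2 ℕ.* k)) K
    ≡⟨ cong (s * c *_) (binom-pascal₂ (+ (2 ℕ.* k)) K) ⟩
  s * c * (binom (+ (2 ℕ.* k)) K + + 2 * binom (+ (2 ℕ.* k)) (K - + 1) + binom (+ (2 ℕ.* k)) (K - + 2))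
    ≡⟨ cong₂ (λ K₁ K₂ → s * c * (binom (+ (2 ℕ.* k)) K + + 2 * binom (+ (2 ℕ.* k)) K₁ + binom (+ (2 ℕ.* k)) K₂))
             (k+[b+1]-1≡k+b (+ k) b) (k+[b+1]-2≡k+[b-1] (+ k) b) ⟩
  s * c * (binom (+ (2 ℕ.* k)) K + + 2 * binom (+ (2 ℕ.* k)) (+ k + b) + binom (+ (2 ℕ.* k)) (+ k + (b - + 1)))
    ≡⟨ distrib s c _ _ _ ⟩
  lhsKernel (a - + 1) (b + + 1) n k + + 2 * lhsKernel (a - + 1) b n k + lhsKernel (a - + 1) (b - + 1) n k ∎
  where
  open ≡-Reasoning
  s = sgnPow (a - + 1 - + k)
  c = binom (a - + 1 - + k) n
  K = + k + (b + + 1)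
  a-[1+k]≡a-1-k : ∀ a k → a - (+ 1 + k) ≡ a - + 1 - k
  a-[1+k]≡a-1-k = solve-∀
  [1+k]+b≡k+[b+1] : ∀ k b → + 1 + k + b ≡ k + (b + + 1)
  [1+k]+b≡k+[b+1] = solve-∀
  k+[b+1]-1≡k+b : ∀ k b → k + (b + + 1) - + 1 ≡ k + b
  k+[b+1]-1≡k+b = solve-∀
  k+[b+1]-2≡k+[b-1] : ∀ k b → k + (b + + 1) - + 2 ≡ k + (b - + 1)
  k+[b+1]-2≡k+[b-1] = solve-∀
  distrib : ∀ s c x y z → s * c * (x + + 2 * y + z) ≡ s * c * x + + 2 * (s * c * y) + s * c * z
  distrib = solve-∀

lhsSum-1+ : ∀ l a b n → lhsSum l (+ 1 + a) b n ≡ - (lhsSum l a b n + lhsSum l a b (n - + 1))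
lhsSum-1+ l a b n = begin
  lhsSum l (+ 1 + a) b n
    ≡⟨ binomialSum-cong l (lhsKernel-1+ a b n) ⟩
  binomialSum l (λ k → - (lhsKernel a b n k + lhsKernel a b (n - + 1) k))
    ≡⟨ binomialSum-neg l _ ⟩
  - binomialSum l (λ k → lhsKernel a b n k + lhsKernel a b (n - + 1) k)
    ≡⟨ cong -_ (binomialSum-+ l _ _) ⟩
  - (lhsSum l a b n + lhsSum l a b (n - + 1)) ∎
  where open ≡-Reasoning

lhsSum-2+ : ∀ l a b n → lhsSum l (+ 2 + a) b n ≡ lhsSum l a b n + + 2 * lhsSum l a b (n - + 1) + lhsSum l a b (n - + 2)
lhsSum-2+ l a b n = binomialSum-1-2-1 l (lhsKernel-2+ a b n)

lhsSum-suc : ∀ l a b n → lhsSum (suc l) a b n ≡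
  lhsSum l a b n + (lhsSum l (a - + 1) (b + + 1) n + + 2 * lhsSum l (a - + 1) b n + lhsSum l (a - + 1) (b - + 1) n)
lhsSum-suc l a b n = trans (binomialSum-suc l (lhsKernel a b n))
                           (cong (λ t → lhsSum l a b n + t) (binomialSum-1-2-1 l (lhsKernel-suc a b n)))

rhsKernel : ℤ → ℤ → ℤ → ℕ → ℤ
rhsKernel a n M k = binom (+ (2 ℕ.* k)) n * binom a (a + M - + (3 ℕ.* k))

rhsSum : ℕ → ℤ → ℤ → ℤ → ℤ
rhsSum l a n M = binomialSum l (rhsKernel a n M)

rhsKernel-1+ : ∀ a n M k → rhsKernel (+ 1 + a) n M k ≡ rhsKernel a n (M + + 1) k + rhsKernel a n M k
rhsKernel-1+ a n M k = begin
  c * binom (+ 1 + a) (+ 1 + a + M - q)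
    ≡⟨ cong (c *_) (binom-pascal a (+ 1 + a + M - q)) ⟩
  c * (binom a (+ 1 + a + M - q) + binom a (+ 1 + a + M - q - + 1))
    ≡⟨ cong₂ (λ K₀ K₁ → c * (binom a K₀ + binom a K₁)) (shift₀ a M q) (shift₁ a M q) ⟩
  c * (binom a (a + (M + + 1) - q) + binom a (a + M - q))
    ≡⟨ *-distribˡ-+ c (binom a (a + (M + + 1) - q)) (binom a (a + M - q)) ⟩
  rhsKernel a n (M + + 1) k + rhsKernel a n M k ∎
  where
  open ≡-Reasoning
  c = binom (+ (2 ℕ.* k)) n
  q = + (3 ℕ.* k)
  shift₀ : ∀ a M q → + 1 + a + M - q ≡ a + (M + + 1) - q
  shift₀ = solve-∀
  shift₁ : ∀ a M q → + 1 + a + M - q - + 1 ≡ a + M - q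
  shift₁ = solve-∀

rhsKernel-2+ : ∀ a n M k →
  rhsKernel (+ 2 + a) n M k ≡ rhsKernel a n (M + + 2) k + + 2 * rhsKernel a n (M + + 1) k + rhsKernel a n M k
rhsKernel-2+ a n M k = begin
  c * binom (+ 2 + a) (+ 2 + a + M - q)
    ≡⟨ cong (c *_) (binom-pascal₂ a (+ 2 + a + M - q)) ⟩
  c * (binom a (+ 2 + a + M - q) + + 2 * binom a (+ 2 + a + M - q - + 1) + binom a (+ 2 + a + M - q - + 2))
    ≡⟨ cong₂ (λ K₀ K₁ → c * (binom a K₀ + + 2 * binom a K₁ + binom a (+ 2 + a + M - q - + 2)))
             (shift₀ a M q) (shift₁ a M q) ⟩
  c * (binom a (a + (M + + 2) - q) + + 2 * binom a (a + (M + + 1) - q) + binom a (+ 2 + a + M - q - + 2))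
    ≡⟨ cong (λ K₂ → c * (binom a (a + (M + + 2) - q) + + 2 * binom a (a + (M + + 1) - q) + binom a K₂))
            (shift₂ a M q) ⟩
  c * (binom a (a + (M + + 2) - q) + + 2 * binom a (a + (M + + 1) - q) + binom a (a + M - q))
    ≡⟨ distrib c (binom a (a + (M + + 2) - q)) (binom a (a + (M + + 1) - q)) (binom a (a + M - q)) ⟩
  rhsKernel a n (M + + 2) k + + 2 * rhsKernel a n (M + + 1) k + rhsKernel a n M k ∎
  where
  open ≡-Reasoning
  c = binom (+ (2 ℕ.* k)) n
  q = + (3 ℕ.* k)
  shift₀ : ∀ a M q → + 2 + a + M - q ≡ a + (M + + 2) - q
  shift₀ = solve-∀
  shift₁ : ∀ a M q → + 2 + a + M - q - + 1 ≡ a + (M + + 1) - q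
  shift₁ = solve-∀
  shift₂ : ∀ a M q → + 2 + a + M - q - + 2 ≡ a + M - q
  shift₂ = solve-∀
  distrib : ∀ c x y z → c * (x + + 2 * y + z) ≡ c * x + + 2 * (c * y) + c * z
  distrib = solve-∀

rhsKernel-suc : ∀ a n M k → rhsKernel a n M (suc k) ≡
  rhsKernel a n (M - + 3) k + + 2 * rhsKernel a (n - + 1) (M - + 3) k + rhsKernel a (n - + 2) (M - + 3) k
rhsKernel-suc a n M k = begin
  binom (+ (2 ℕ.* suc k)) n * binom a (a + M - + (3 ℕ.* suc k))
    ≡⟨ cong₂ (λ y q → binom y n * binom a (a + M - q)) (pos-*-suc 2 k) (pos-*-suc 3 k) ⟩
  binom (+ 2 + + (2 ℕ.* k)) n * binom a (a + M - (+ 3 + + (3 ℕ.* k)))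
    ≡⟨ cong₂ _*_ (binom-pascal₂ (+ (2 ℕ.* k)) n) (cong (binom a) (shift a M (+ (3 ℕ.* k)))) ⟩
  (binom (+ (2 ℕ.* k)) n + + 2 * binom (+ (2 ℕ.* k)) (n - + 1) + binom (+ (2 ℕ.* k)) (n - + 2)) * c
    ≡⟨ distrib (binom (+ (2 ℕ.* k)) n) (binom (+ (2 ℕ.* k)) (n - + 1)) (binom (+ (2 ℕ.* k)) (n - + 2)) c ⟩
  rhsKernel a n (M - + 3) k + + 2 * rhsKernel a (n - + 1) (M - + 3) k + rhsKernel a (n - + 2) (M - + 3) k ∎
  where
  open ≡-Reasoning
  c = binom a (a + (M - + 3) - + (3 ℕ.* k))
  shift : ∀ a M q → a + M - (+ 3 + q) ≡ a + (M - + 3) - q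
  shift = solve-∀
  distrib : ∀ x y z c → (x + + 2 * y + z) * c ≡ x * c + + 2 * (y * c) + z * c
  distrib = solve-∀

rhsSum-1+ : ∀ l a n M → rhsSum l (+ 1 + a) n M ≡ rhsSum l a n (M + + 1) + rhsSum l a n M
rhsSum-1+ l a n M = trans (binomialSum-cong l (rhsKernel-1+ a n M)) (binomialSum-+ l _ _)

rhsSum-2+ : ∀ l a n M → rhsSum l (+ 2 + a) n M ≡ rhsSum l a n (M + + 2) + + 2 * rhsSum l a n (M + + 1) + rhsSum l a n M
rhsSum-2+ l a n M = binomialSum-1-2-1 l (rhsKernel-2+ a n M)

rhsSum-suc : ∀ l a n M → rhsSum (suc l) a n M ≡
  rhsSum l a n M + (rhsSum l a n (M - + 3) + + 2 * rhsSum l a (n - + 1) (M - + 3) + rhsSum l a (n - + 2) (M - + 3))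
rhsSum-suc l a n M = trans (binomialSum-suc l (rhsKernel a n M))
                           (cong (λ t → rhsSum l a n M + t) (binomialSum-1-2-1 l (rhsKernel-suc a n M)))

lhs : ℕ → ℤ → ℤ → ℤ
lhs l M N = lhsSum l M (M - + (2 ℕ.* l)) N

rhs : ℕ → ℤ → ℤ → ℤ
rhs l M N = rhsSum l (N - + l) N M

-- On generating functions Σ F M N xᴹ yᴺ, step multiplies by x − x² + x³ + 2x³y + x²y² + x³y²
-- and stepPair by 1 + x³ + 2x²y(1 + x) + xy²(1 + x)², so that (1 + x) · step = x · stepPair.
step : (ℤ → ℤ → ℤ) → ℤ → ℤ → ℤ
step F M N = F (M - + 1) N - F (M - + 2) N + F (M - + 2) (N - + 2)
           + F (M - + 3) N + + 2 * F (M - + 3) (N - + 1) + F (M - + 3) (N - + 2)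

stepPair : (ℤ → ℤ → ℤ) → ℤ → ℤ → ℤ
stepPair F M N = F M N + (F (M - + 3) N + + 2 * (F (M - + 2) (N - + 1) + F (M - + 3) (N - + 1))
                          + (F (M - + 1) (N - + 2) + + 2 * F (M - + 2) (N - + 2) + F (M - + 3) (N - + 2)))

step-pair : ∀ F M N → step F M N + step F (M - + 1) N ≡ stepPair F (M - + 1) N
step-pair F M N
  rewrite +-assoc M (- + 1) (- + 1) | +-assoc M (- + 1) (- + 2) | +-assoc M (- + 1) (- + 3) =
  collect (F (M - + 1) N) (F (M - + 2) N) (F (M - + 2) (N - + 2)) (F (M - + 3) N) (F (M - + 3) (N - + 1))
          (F (M - + 3) (N - + 2)) (F (M - + 4) N) (F (M - + 4) (N - + 1)) (F (M - + 4) (N - + 2))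
  where
  collect : ∀ x₁ x₂ z₂ x₃ y₃ z₃ x₄ y₄ z₄ →
    (x₁ - x₂ + z₂ + x₃ + + 2 * y₃ + z₃) + (x₂ - x₃ + z₃ + x₄ + + 2 * y₄ + z₄)
      ≡ x₁ + (x₄ + + 2 * (y₃ + y₄) + (z₂ + + 2 * z₃ + z₄))
  collect = solve-∀

step-cong : ∀ {F G : ℤ → ℤ → ℤ} → (∀ M N → F M N ≡ G M N) → ∀ M N → step F M N ≡ step G M N
step-cong F≡G M N
  rewrite F≡G (M - + 1) N | F≡G (M - + 2) N | F≡G (M - + 2) (N - + 2)
        | F≡G (M - + 3) N | F≡G (M - + 3) (N - + 1) | F≡G (M - + 3) (N - + 2) = refl

step-vanishes : ∀ {F : ℤ → ℤ → ℤ} → (∀ {M} N → M < + 0 → F M N ≡ + 0) → ∀ N → step F -1ℤ N ≡ + 0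
step-vanishes {F} F≡0 N = begin
  step F -1ℤ N
    ≡⟨ cong₂ _+_ (cong₂ _+_ (cong₂ _+_ (cong₂ _+_ (cong₂ _-_ (F≡0 N -<+) (F≡0 N -<+))
                                                  (F≡0 (N - + 2) -<+))
                                       (F≡0 N -<+))
                            (cong (+ 2 *_) (F≡0 (N - + 1) -<+)))
                 (F≡0 (N - + 2) -<+) ⟩
  + 0 - + 0 + + 0 + + 0 + + 2 * + 0 + + 0
    ≡⟨⟩
  + 0 ∎
  where open ≡-Reasoning

lhs-suc : ∀ l M N → let L = + (2 ℕ.* l) in
  lhs (suc l) M N ≡ lhsSum l (+ 2 + (M - + 2)) (M - + 2 - L) N
                    + (lhs l (M - + 1) N + + 2 * lhsSum l (+ 1 + (M - + 2)) (M - + 2 - L) N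
                       + lhsSum l (+ 2 + (M - + 3)) (M - + 3 - L) N)
lhs-suc l M N = begin
  lhsSum (suc l) M (M - + (2 ℕ.* suc l)) N
    ≡⟨ cong (λ b → lhsSum (suc l) M b N) (trans (cong (_-_ M) (pos-*-suc 2 l)) (M-[2+L]≡M-2-L M L)) ⟩
  lhsSum (suc l) M b N
    ≡⟨ lhsSum-suc l M b N ⟩
  lhsSum l M b N + (lhsSum l (M - + 1) (b + + 1) N + + 2 * lhsSum l (M - + 1) b N + lhsSum l (M - + 1) (b - + 1) N)
    ≡⟨ cong₂ _+_ (cong (λ a → lhsSum l a b N) (M≡2+[M-2] M))
         (cong₂ _+_ (cong₂ (λ b′ a → lhsSum l (M - + 1) b′ N + + 2 * lhsSum l a b N)
                           (M-2-L+1≡M-1-L M L) (M-1≡1+[M-2] M))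
                    (cong₂ (λ a b′ → lhsSum l a b′ N) (M-1≡2+[M-3] M) (M-2-L-1≡M-3-L M L))) ⟩
  lhsSum l (+ 2 + (M - + 2)) b N
    + (lhs l (M - + 1) N + + 2 * lhsSum l (+ 1 + (M - + 2)) b N + lhsSum l (+ 2 + (M - + 3)) (M - + 3 - L) N) ∎
  where
  open ≡-Reasoning
  L = + (2 ℕ.* l)
  b = M - + 2 - L
  M-[2+L]≡M-2-L : ∀ M L → M - (+ 2 + L) ≡ M - + 2 - L
  M-[2+L]≡M-2-L = solve-∀
  M-2-L+1≡M-1-L : ∀ M L → M - + 2 - L + + 1 ≡ M - + 1 - L
  M-2-L+1≡M-1-L = solve-∀
  M-2-L-1≡M-3-L : ∀ M L → M - + 2 - L - + 1 ≡ M - + 3 - L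
  M-2-L-1≡M-3-L = solve-∀
  M≡2+[M-2] : ∀ M → M ≡ + 2 + (M - + 2)
  M≡2+[M-2] = solve-∀
  M-1≡1+[M-2] : ∀ M → M - + 1 ≡ + 1 + (M - + 2)
  M-1≡1+[M-2] = solve-∀
  M-1≡2+[M-3] : ∀ M → M - + 1 ≡ + 2 + (M - + 3)
  M-1≡2+[M-3] = solve-∀

lhs-step : ∀ l M N → lhs (suc l) M N ≡ step (lhs l) M N
lhs-step l M N = begin
  lhs (suc l) M N
    ≡⟨ lhs-suc l M N ⟩
  lhsSum l (+ 2 + M₂) (M₂ - L) N + (F M₁ N + + 2 * lhsSum l (+ 1 + M₂) (M₂ - L) N + lhsSum l (+ 2 + M₃) (M₃ - L) N)
    ≡⟨ cong₂ _+_ (lhsSum-2+ l M₂ (M₂ - L) N)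
                 (cong₂ (λ x y → F M₁ N + + 2 * x + y) (lhsSum-1+ l M₂ (M₂ - L) N) (lhsSum-2+ l M₃ (M₃ - L) N)) ⟩
  (F M₂ N + + 2 * F M₂ (N - + 1) + F M₂ (N - + 2))
    + (F M₁ N + + 2 * - (F M₂ N + F M₂ (N - + 1)) + (F M₃ N + + 2 * F M₃ (N - + 1) + F M₃ (N - + 2)))
    ≡⟨ collect (F M₂ N) (F M₂ (N - + 1)) (F M₂ (N - + 2)) (F M₁ N) (F M₃ N) (F M₃ (N - + 1)) (F M₃ (N - + 2)) ⟩
  step (lhs l) M N ∎
  where
  open ≡-Reasoning
  F = lhs l
  L = + (2 ℕ.* l)
  M₁ = M - + 1
  M₂ = M - + 2
  M₃ = M - + 3
  collect : ∀ x₂ y₂ z₂ x₁ x₃ y₃ z₃ →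
    (x₂ + + 2 * y₂ + z₂) + (x₁ + + 2 * - (x₂ + y₂) + (x₃ + + 2 * y₃ + z₃))
      ≡ x₁ - x₂ + z₂ + x₃ + + 2 * y₃ + z₃
  collect = solve-∀

rhs-merge : ∀ l M N → rhs (suc l) M N + rhs (suc l) (M - + 1) N ≡ rhsSum (suc l) (N - + l) N (M - + 1)
rhs-merge l M N = begin
  rhsSum (suc l) a N M + rhsSum (suc l) a N (M - + 1)
    ≡⟨ cong (λ t → rhsSum (suc l) a N t + rhsSum (suc l) a N (M - + 1)) (M≡M-1+1 M) ⟩
  rhsSum (suc l) a N (M - + 1 + + 1) + rhsSum (suc l) a N (M - + 1)
    ≡⟨ rhsSum-1+ (suc l) a N (M - + 1) ⟨
  rhsSum (suc l) (+ 1 + a) N (M - + 1)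
    ≡⟨ cong (λ a → rhsSum (suc l) a N (M - + 1)) (1+[N-[1+l]]≡N-l N (+ l)) ⟩
  rhsSum (suc l) (N - + l) N (M - + 1) ∎
  where
  open ≡-Reasoning
  a = N - + suc l
  M≡M-1+1 : ∀ M → M ≡ M - + 1 + + 1
  M≡M-1+1 = solve-∀
  1+[N-[1+l]]≡N-l : ∀ N l → + 1 + (N - (+ 1 + l)) ≡ N - l
  1+[N-[1+l]]≡N-l = solve-∀

rhsSum-suc-stepPair : ∀ l M N → rhsSum (suc l) (N - + l) N M ≡ stepPair (rhs l) M N
rhsSum-suc-stepPair l M N = begin
  rhsSum (suc l) a N M
    ≡⟨ rhsSum-suc l a N M ⟩
  F M N + (F (M - + 3) N + + 2 * rhsSum l a (N - + 1) (M - + 3) + rhsSum l a (N - + 2) (M - + 3))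
    ≡⟨ cong₂ (λ a₁ a₂ → F M N + (F (M - + 3) N + + 2 * rhsSum l a₁ (N - + 1) (M - + 3)
                                 + rhsSum l a₂ (N - + 2) (M - + 3)))
             (N-l≡1+[N-1-l] N (+ l)) (N-l≡2+[N-2-l] N (+ l)) ⟩
  F M N + (F (M - + 3) N + + 2 * rhsSum l (+ 1 + a₁) (N - + 1) (M - + 3) + rhsSum l (+ 2 + a₂) (N - + 2) (M - + 3))
    ≡⟨ cong₂ (λ x y → F M N + (F (M - + 3) N + + 2 * x + y))
             (rhsSum-1+ l a₁ (N - + 1) (M - + 3)) (rhsSum-2+ l a₂ (N - + 2) (M - + 3)) ⟩
  F M N + (F (M - + 3) N + + 2 * (rhsSum l a₁ (N - + 1) (M - + 3 + + 1) + F (M - + 3) (N - + 1))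
    + (rhsSum l a₂ (N - + 2) (M - + 3 + + 2) + + 2 * rhsSum l a₂ (N - + 2) (M - + 3 + + 1) + F (M - + 3) (N - + 2)))
    ≡⟨ cong₂ (λ M₂ M₁ → F M N + (F (M - + 3) N + + 2 * (F M₂ (N - + 1) + F (M - + 3) (N - + 1))
                         + (F M₁ (N - + 2) + + 2 * F M₂ (N - + 2) + F (M - + 3) (N - + 2))))
             (+-assoc M (- + 3) (+ 1)) (+-assoc M (- + 3) (+ 2)) ⟩
  stepPair F M N ∎
  where
  open ≡-Reasoning
  F = rhs l
  a = N - + l
  a₁ = N - + 1 - + l
  a₂ = N - + 2 - + l
  N-l≡1+[N-1-l] : ∀ N l → N - l ≡ + 1 + (N - + 1 - l)
  N-l≡1+[N-1-l] = solve-∀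
  N-l≡2+[N-2-l] : ∀ N l → N - l ≡ + 2 + (N - + 2 - l)
  N-l≡2+[N-2-l] = solve-∀

rhs-negative : ∀ l {M} N → M < + 0 → rhs l M N ≡ + 0
rhs-negative l {M} N M<0 =
  sumTo-zero l (λ k → trans (cong (binom (+ l) (+ k) *_) (kernel-vanishes k)) (*-zeroʳ (binom (+ l) (+ k))))
  where
  kernel-vanishes : ∀ k → rhsKernel (N - + l) N M k ≡ + 0
  kernel-vanishes k with N ≤? + (2 ℕ.* k)
  ... | no  N≰2k = trans (cong (_* binom (N - + l) (N - + l + M - + (3 ℕ.* k))) (n<K⇒binom≡0 N (≰⇒> N≰2k)))
                         (*-zeroˡ (binom (N - + l) (N - + l + M - + (3 ℕ.* k))))
  ... | yes N≤2k = trans (cong (binom (+ (2 ℕ.* k)) N *_) (K<0⇒binom≡0 (N - + l) index<0))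
                         (*-zeroʳ (binom (+ (2 ℕ.* k)) N))
    where
    N≤3k : N ≤ + (3 ℕ.* k)
    N≤3k = ≤-trans N≤2k (+≤+ (ℕP.*-monoˡ-≤ k (ℕP.n≤1+n 2)))
    rearrange : ∀ N l M q → N - q - l + M ≡ N - l + M - q
    rearrange = solve-∀
    index<0 : N - + l + M - + (3 ℕ.* k) < + 0
    index<0 = subst (_< + 0) (rearrange N (+ l) M (+ (3 ℕ.* k)))
                    (+-mono-≤-< (i≤j⇒i-k≤j (+ l) (i≤j⇒i-j≤0 N≤3k)) M<0)

rhs-step : ∀ l M N → rhs (suc l) M N ≡ step (rhs l) M N
rhs-step l M N =
  ≡-from-consecutive-sums {λ M → rhs (suc l) M N} {λ M → step (rhs l) M N} at-−1 consecutive M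
  where
  at-−1 : rhs (suc l) -1ℤ N ≡ step (rhs l) -1ℤ N
  at-−1 = trans (rhs-negative (suc l) N -<+) (sym (step-vanishes (rhs-negative l) N))
  consecutive : ∀ M → rhs (suc l) M N + rhs (suc l) (M - + 1) N ≡ step (rhs l) M N + step (rhs l) (M - + 1) N
  consecutive M = trans (rhs-merge l M N)
                        (trans (rhsSum-suc-stepPair l (M - + 1) N) (sym (step-pair (rhs l) M N)))

lhs-0 : ∀ M N → lhs 0 M N ≡ binom (+ 0) M * binom (+ 0) N
lhs-0 M N = begin
  + 1 * (sgnPow (M - + 0) * binom (M - + 0) N * binom (+ 0) (+ 0 + (M - + 0)))
    ≡⟨ *-identityˡ _ ⟩
  sgnPow (M - + 0) * binom (M - + 0) N * binom (+ 0) (+ 0 + (M - + 0))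
    ≡⟨ cong (λ K → sgnPow (M - + 0) * binom (M - + 0) N * binom (+ 0) K) (+-identityˡ (M - + 0)) ⟩
  sgnPow (M - + 0) * binom (M - + 0) N * binom (+ 0) (M - + 0)
    ≡⟨ cong (λ M′ → sgnPow M′ * binom M′ N * binom (+ 0) M′) (+-identityʳ M) ⟩
  sgnPow M * binom M N * binom (+ 0) M
    ≡⟨ kronecker M ⟩
  binom (+ 0) M * binom (+ 0) N ∎
  where
  open ≡-Reasoning
  kronecker : ∀ M → sgnPow M * binom M N * binom (+ 0) M ≡ binom (+ 0) M * binom (+ 0) N
  kronecker (+ zero)  = *-identityʳ (+ 1 * binom (+ 0) N)
  kronecker (+ suc m) rewrite n<K⇒binom≡0 {0} (+ suc m) (+<+ (s≤s z≤n)) = *-zeroʳ (sgnPow (+ suc m) * binom (+ suc m) N)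
  kronecker -[1+ j ]  = *-zeroʳ (sgnPow -[1+ j ] * binom -[1+ j ] N)

rhs-0 : ∀ M N → rhs 0 M N ≡ binom (+ 0) M * binom (+ 0) N
rhs-0 M N = begin
  + 1 * (binom (+ 0) N * binom (N - + 0) (N - + 0 + M - + 0))
    ≡⟨ *-identityˡ _ ⟩
  binom (+ 0) N * binom (N - + 0) (N - + 0 + M - + 0)
    ≡⟨ cong₂ (λ a K → binom (+ 0) N * binom a K) (+-identityʳ N) (N-0+M-0≡N+M N M) ⟩
  binom (+ 0) N * binom N (N + M)
    ≡⟨ kronecker N ⟩
  binom (+ 0) M * binom (+ 0) N ∎
  where
  open ≡-Reasoning
  N-0+M-0≡N+M : ∀ N M → N - + 0 + M - + 0 ≡ N + M
  N-0+M-0≡N+M = solve-∀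
  kronecker : ∀ N → binom (+ 0) N * binom N (N + M) ≡ binom (+ 0) M * binom (+ 0) N
  kronecker (+ zero)  = trans (cong (λ K → + 1 * binom (+ 0) K) (+-identityˡ M)) (*-comm (+ 1) (binom (+ 0) M))
  kronecker (+ suc n) rewrite n<K⇒binom≡0 {0} (+ suc n) (+<+ (s≤s z≤n)) = sym (*-zeroʳ (binom (+ 0) M))
  kronecker -[1+ j ]  = sym (*-zeroʳ (binom (+ 0) M))

lhs≡rhs : ∀ l M N → lhs l M N ≡ rhs l M N
lhs≡rhs zero    M N = trans (lhs-0 M N) (sym (rhs-0 M N))
lhs≡rhs (suc l) M N = begin
  lhs (suc l) M N   ≡⟨ lhs-step l M N ⟩
  step (lhs l) M N  ≡⟨ step-cong (lhs≡rhs l) M N ⟩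
  step (rhs l) M N  ≡⟨ rhs-step l M N ⟨
  rhs (suc l) M N   ∎
  where open ≡-Reasoning

lhs-as-sum : ∀ l M N →
  sumTo l (λ k → sgnPow (M - + k) * binom (+ l) (+ k) * binom (M - + k) N * binom (+ (2 ℕ.* k)) (+ k - + (2 ℕ.* l) + M))
  ≡ lhs l M N
lhs-as-sum l M N = sumTo-cong l summand
  where
  k-L+M≡k+[M-L] : ∀ k L M → k - L + M ≡ k + (M - L)
  k-L+M≡k+[M-L] = solve-∀
  reorder : ∀ s c a d → s * c * a * d ≡ c * (s * a * d)
  reorder = solve-∀
  summand : ∀ k → sgnPow (M - + k) * binom (+ l) (+ k) * binom (M - + k) N * binom (+ (2 ℕ.* k)) (+ k - + (2 ℕ.* l) + M)
                ≡ binom (+ l) (+ k) * lhsKernel M (M - + (2 ℕ.* l)) N k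
  summand k = trans (cong (λ K → sgnPow (M - + k) * binom (+ l) (+ k) * binom (M - + k) N * binom (+ (2 ℕ.* k)) K)
                          (k-L+M≡k+[M-L] (+ k) (+ (2 ℕ.* l)) M))
                    (reorder (sgnPow (M - + k)) (binom (+ l) (+ k)) (binom (M - + k) N)
                             (binom (+ (2 ℕ.* k)) (+ k + (M - + (2 ℕ.* l)))))

rhs-as-sum : ∀ l M N →
  sumTo l (λ k → binom (+ l) (+ k) * binom (+ (2 ℕ.* k)) N * binom (N - + l) (M + N - + (3 ℕ.* k) - + l))
  ≡ rhs l M N
rhs-as-sum l M N = sumTo-cong l summand
  where
  M+N-q-l≡N-l+M-q : ∀ M N q l → M + N - q - l ≡ N - l + M - q
  M+N-q-l≡N-l+M-q = solve-∀
  summand : ∀ k → binom (+ l) (+ k) * binom (+ (2 ℕ.* k)) N * binom (N - + l) (M + N - + (3 ℕ.* k) - + l)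
                ≡ binom (+ l) (+ k) * rhsKernel (N - + l) N M k
  summand k = trans (cong (λ K → binom (+ l) (+ k) * binom (+ (2 ℕ.* k)) N * binom (N - + l) K)
                          (M+N-q-l≡N-l+M-q M N (+ (3 ℕ.* k)) (+ l)))
                    (*-assoc (binom (+ l) (+ k)) (binom (+ (2 ℕ.* k)) N)
                             (binom (N - + l) (N - + l + M - + (3 ℕ.* k))))

theorem1p1 : (l m n : ℕ) →
    sumTo l (λ k → sgnPow (+ m - + k) * binom (+ l) (+ k) * binom (+ m - + k) (+ n)
                     * binom (+ (2 Data.Nat.* k)) (+ k - + (2 Data.Nat.* l) + + m))
    ≡ sumTo l (λ k → binom (+ l) (+ k) * binom (+ (2 Data.Nat.* k)) (+ n)
                     * binom (+ n - + l) (+ m + + n - + (3 Data.Nat.* k) - + l))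
theorem1p1 l m n = begin
  _                  ≡⟨ lhs-as-sum l (+ m) (+ n) ⟩
  lhs l (+ m) (+ n)  ≡⟨ lhs≡rhs l (+ m) (+ n) ⟩
  rhs l (+ m) (+ n)  ≡⟨ rhs-as-sum l (+ m) (+ n) ⟨
  _                  ∎
  where open ≡-Reasoning
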